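{- Let $H$ be a subgroup of a group $G$. Then $D(H)$ is an induced subgraph of $D(G)$.
   Context: For a group $G$, the power graph $\mathsf{Pow}(G)$ has vertex set $G$, with distinct $a,b$ adjacent iff $a\in\langle b\rangle$ or $b\in\langle a\rangle$. The enhanced power graph $\mathsf{EPow}(G)$ has vertex set $G$, with distinct $a,b$ adjacent iff $\langle a,b\rangle$ is cyclic. The difference graph $D(G)$ is the graph $\mathsf{EPow}(G)-\mathsf{Pow}(G)$ with all isolated vertices removed; thus $x\sim y$ in $D(G)$ iff $\langle x,y\rangle$ is cyclic, $x\notin\langle y\rangle$ and $y\notin\langle x\rangle$. -}

module Defs where

open import Level using (Level; _⊔_)
open import Algebra.Bundles using (Group)
open import Data.Nat using (ℕ; zero; suc)
open import Data.Integer using (ℤ; +_; -[1+_])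
open import Data.Product using (Σ; ∃; _×_; _,_; proj₁; proj₂)
open import Relation.Nullary using (¬_)
open import Relation.Unary using (Pred)

private variable c ℓ p : Level

module _ (G : Group c ℓ) where
  open Group G

  powℕ : Carrier → ℕ → Carrier
  powℕ g zero    = ε
  powℕ g (suc n) = g ∙ powℕ g n

  powℤ : Carrier → ℤ → Carrier
  powℤ g (+ n)    = powℕ g n
  powℤ g -[1+ n ] = (powℕ g (suc n)) ⁻¹

  InCyc : Carrier → Carrier → Set ℓ
  InCyc a b = ∃ λ (k : ℤ) → a ≈ powℤ b k

  data InGen (x y : Carrier) : Carrier → Set (c ⊔ ℓ) where
    gen-x : InGen x y x
    gen-y : InGen x y y
    gen-ε : InGen x y ε
    gen-∙ : ∀ {a b} → InGen x y a → InGen x y b → InGen x y (a ∙ b)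
    gen-⁻¹ : ∀ {a} → InGen x y a → InGen x y (a ⁻¹)
    gen-≈ : ∀ {a b} → a ≈ b → InGen x y a → InGen x y b

  -- ⟨ x , y ⟩ is cyclic: ⟨ x , y ⟩ = ⟨ g ⟩ for some g, i.e. g ∈ ⟨ x , y ⟩
  -- and x , y ∈ ⟨ g ⟩.
  GenCyclic : Carrier → Carrier → Set (c ⊔ ℓ)
  GenCyclic x y = ∃ λ g → InGen x y g × InCyc x g × InCyc y g

  -- adjacency in the difference graph D(G) = EPow(G) - Pow(G)
  DAdj : Carrier → Carrier → Set (c ⊔ ℓ)
  DAdj x y = GenCyclic x y × ¬ InCyc x y × ¬ InCyc y x

  -- vertices of D(G): the non-isolated vertices of EPow(G) - Pow(G)
  DVertex : Carrier → Set (c ⊔ ℓ)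
  DVertex x = ∃ λ y → DAdj x y

record IsSubgroup (G : Group c ℓ) (H : Pred (Group.Carrier G) p)
       : Set (c ⊔ ℓ ⊔ p) where
  open Group G
  field
    resp   : ∀ {a b} → a ≈ b → H a → H b
    ε-mem  : H ε
    ∙-mem  : ∀ {a b} → H a → H b → H (a ∙ b)
    ⁻¹-mem : ∀ {a} → H a → H (a ⁻¹)

module _ (G : Group c ℓ) {H : Pred (Group.Carrier G) p} (S : IsSubgroup G H) where
  open Group G
  open IsSubgroup S

  SubCarrier : Set (c ⊔ p)
  SubCarrier = Σ Carrier H

  subGroup : Group (c ⊔ p) ℓ
  subGroup = record
    { Carrier = SubCarrier
    ; _≈_ = λ a b → proj₁ a ≈ proj₁ b
    ; _∙_ = λ a b → (proj₁ a ∙ proj₁ b , ∙-mem (proj₂ a) (proj₂ b))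
    ; ε = (ε , ε-mem)
    ; _⁻¹ = λ a → (proj₁ a ⁻¹ , ⁻¹-mem (proj₂ a))
    ; isGroup = record
      { isMonoid = record
        { isSemigroup = record
          { isMagma = record
            { isEquivalence = record { refl = refl ; sym = sym ; trans = trans }
            ; ∙-cong = ∙-cong }
          ; assoc = λ a b d → assoc (proj₁ a) (proj₁ b) (proj₁ d) }
        ; identity = (λ a → identityˡ (proj₁ a)) , (λ a → identityʳ (proj₁ a)) }
      ; inverse = (λ a → inverseˡ (proj₁ a)) , (λ a → inverseʳ (proj₁ a))
      ; ⁻¹-cong = ⁻¹-cong }
    }

module Submission where

open import Defs
open import Level using (Level)
open import Algebra.Bundles using (Group)
open import Data.Product using (_×_; proj₁; proj₂; _,_)
open import Relation.Unary using (Pred)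
open import Function.Bundles using (_⇔_; mk⇔; Equivalence)
open import Data.Nat using (zero; suc)
open import Data.Integer using (+_; -[1+_])
open import Relation.Binary.PropositionalEquality using (_≡_; refl; cong; subst; sym)

-- Powers of an element of H, and the subgroup generated by two elements of H,
-- are the same whether computed in H or in G, while H carries the equality of G.
-- Hence "⟨x, y⟩ is cyclic" and "x ∈ ⟨y⟩" mean the same in H and in G, and so
-- does adjacency in the difference graph.

private variable c ℓ p : Level

module _ (G : Group c ℓ) {H : Pred (Group.Carrier G) p} (S : IsSubgroup G H) where
  open Group G using (_≈_; _∙_; _⁻¹)
  open IsSubgroup S

  inGen⊆ : ∀ {x y a} → H x → H y → InGen G x y a → H a
  inGen⊆ hx hy gen-x         = hx
  inGen⊆ hx hy gen-y         = hy
  inGen⊆ hx hy gen-ε         = ε-mem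
  inGen⊆ hx hy (gen-∙ ga gb) = ∙-mem (inGen⊆ hx hy ga) (inGen⊆ hx hy gb)
  inGen⊆ hx hy (gen-⁻¹ ga)   = ⁻¹-mem (inGen⊆ hx hy ga)
  inGen⊆ hx hy (gen-≈ e ga)  = resp e (inGen⊆ hx hy ga)

  private K = subGroup G S

  proj₁-powℕ : ∀ (g : SubCarrier G S) n → proj₁ (powℕ K g n) ≡ powℕ G (proj₁ g) n
  proj₁-powℕ g zero    = refl
  proj₁-powℕ g (suc n) = cong (proj₁ g ∙_) (proj₁-powℕ g n)

  proj₁-powℤ : ∀ (g : SubCarrier G S) k → proj₁ (powℤ K g k) ≡ powℤ G (proj₁ g) k
  proj₁-powℤ g (+ n)    = proj₁-powℕ g n
  proj₁-powℤ g -[1+ n ] = cong _⁻¹ (proj₁-powℕ g (suc n))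

  inCyc-sub⇔ : ∀ a b → InCyc K a b ⇔ InCyc G (proj₁ a) (proj₁ b)
  inCyc-sub⇔ a b = mk⇔
    (λ { (k , e) → k , subst (proj₁ a ≈_) (proj₁-powℤ b k) e })
    (λ { (k , e) → k , subst (proj₁ a ≈_) (sym (proj₁-powℤ b k)) e })

  inGen-sub⁺ : ∀ {x y g} → InGen K x y g → InGen G (proj₁ x) (proj₁ y) (proj₁ g)
  inGen-sub⁺ gen-x         = gen-x
  inGen-sub⁺ gen-y         = gen-y
  inGen-sub⁺ gen-ε         = gen-ε
  inGen-sub⁺ (gen-∙ ga gb) = gen-∙ (inGen-sub⁺ ga) (inGen-sub⁺ gb)
  inGen-sub⁺ (gen-⁻¹ ga)   = gen-⁻¹ (inGen-sub⁺ ga)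
  inGen-sub⁺ (gen-≈ e ga)  = gen-≈ e (inGen-sub⁺ ga)

  inGen-sub⁻ : ∀ (x y : SubCarrier G S) {a} (ga : InGen G (proj₁ x) (proj₁ y) a) →
               InGen K x y (a , inGen⊆ (proj₂ x) (proj₂ y) ga)
  inGen-sub⁻ x y gen-x         = gen-x
  inGen-sub⁻ x y gen-y         = gen-y
  inGen-sub⁻ x y gen-ε         = gen-ε
  inGen-sub⁻ x y (gen-∙ ga gb) = gen-∙ (inGen-sub⁻ x y ga) (inGen-sub⁻ x y gb)
  inGen-sub⁻ x y (gen-⁻¹ ga)   = gen-⁻¹ (inGen-sub⁻ x y ga)
  inGen-sub⁻ x y (gen-≈ e ga)  = gen-≈ e (inGen-sub⁻ x y ga)

  genCyclic-sub⇔ : ∀ x y → GenCyclic K x y ⇔ GenCyclic G (proj₁ x) (proj₁ y)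
  genCyclic-sub⇔ x y = mk⇔
    (λ { (g , gg , xg , yg) →
         proj₁ g , inGen-sub⁺ gg , to (inCyc-sub⇔ x g) xg , to (inCyc-sub⇔ y g) yg })
    (λ { (g , gg , xg , yg) → let g′ = (g , inGen⊆ (proj₂ x) (proj₂ y) gg) in
         g′ , inGen-sub⁻ x y gg , from (inCyc-sub⇔ x g′) xg , from (inCyc-sub⇔ y g′) yg })
    where open Equivalence

  dAdj-sub⇔ : ∀ x y → DAdj K x y ⇔ DAdj G (proj₁ x) (proj₁ y)
  dAdj-sub⇔ x y = mk⇔
    (λ { (cyc , x∉y , y∉x) →
         to (genCyclic-sub⇔ x y) cyc , (λ xy → x∉y (from (inCyc-sub⇔ x y) xy))
                                     , (λ yx → y∉x (from (inCyc-sub⇔ y x) yx)) })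
    (λ { (cyc , x∉y , y∉x) →
         from (genCyclic-sub⇔ x y) cyc , (λ xy → x∉y (to (inCyc-sub⇔ x y) xy))
                                       , (λ yx → y∉x (to (inCyc-sub⇔ y x) yx)) })
    where open Equivalence

lemma2p6 : {c ℓ p : Level} (G : Group c ℓ) {H : Pred (Group.Carrier G) p}
           (S : IsSubgroup G H) →
           (∀ (x : SubCarrier G S) →
              DVertex (subGroup G S) x → DVertex G (proj₁ x))
           × (∀ (x y : SubCarrier G S) →
              DAdj (subGroup G S) x y ⇔ DAdj G (proj₁ x) (proj₁ y))
lemma2p6 G S =
  (λ { x (y , x∼y) → proj₁ y , Equivalence.to (dAdj-sub⇔ G S x y) x∼y }) ,
  dAdj-sub⇔ G S
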